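{- Let $(S,\rho)$ be a matroid scheme. The closure map $\mathrm{cl}:S\to S$ satisfies: (CL1) $x\le\mathrm{cl}(x)$ for all $x\in S$; (CL2) if $x\le y$ then $\mathrm{cl}(x)\le\mathrm{cl}(y)$; (CL3) $\mathrm{cl}(\mathrm{cl}(x))=\mathrm{cl}(x)$; (CL4) if $x\in S$, $a,b\in\mathrm{at}(S)$, $u\in x\vee b$, $a\le\mathrm{cl}(u)$ and $a\not\le\mathrm{cl}(x)$, then there exists $v\in x\vee a$ with $v\le\mathrm{cl}(u)$ and $b\le\mathrm{cl}(v)$.
   Context: A finite poset $S$ is a simplicial poset if it has a unique minimum, is ranked, and each $S_{\le x}$ is isomorphic to the Boolean lattice of subsets of the atoms below $x$; $|x|$ is the rank, $\mathrm{at}(S)$ the atoms. $x\vee y$ / $x\wedge y$ are the sets of minimal common upper / maximal common lower bounds. A matroid scheme is $(S,\rho)$, $\rho:S\to\mathbb{Z}_{\ge0}$, with (M1) $0\le\rho(x)\le|x|$; (M2) monotone; (M3) $u\in x\vee y\Rightarrow\rho(x)+\rho(y)\ge\rho(u)+\rho(x\wedge y)$; (M4) $\ell\in x\wedge y,\ \rho(x)=\rho(\ell)\Rightarrow x\vee y\neq\emptyset$; (M5) $\rho(x)<\rho(y)\Rightarrow$ there is an atom $a\le y$, $a\not\le x$, $x\vee a\ne\emptyset$. The closure $\mathrm{cl}(x)$ is the unique maximal element of $\{y\in S:y\ge x,\ \rho(y)=\rho(x)\}$. -}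

module Defs where

open import Data.Nat using (ℕ; _≤_; _<_; _+_)
open import Data.Fin using (Fin) renaming (_≟_ to _≟F_)
open import Data.Fin.Properties using (all?)
open import Data.Fin.Subset using (Subset; _⊆_; ∣_∣)
open import Data.Vec using (tabulate)
open import Data.Product using (_×_; ∃)
open import Relation.Binary.PropositionalEquality using (_≡_)
open import Relation.Binary.Structures using (IsPartialOrder)
open import Relation.Nullary using (¬_; Dec; does; _×-dec_; _→-dec_; ¬?)

-- A finite poset is presented on the carrier Fin n (every finite poset is
-- isomorphic to one of this form), with a decidable order relation.

module PosetNotions {n : ℕ} (_⊑_ : Fin n → Fin n → Set)
                    (_⊑?_ : ∀ x y → Dec (x ⊑ y)) (bot : Fin n) where

  _⊏_ : Fin n → Fin n → Set
  x ⊏ y = x ⊑ y × ¬ (x ≡ y)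

  _⊏?_ : ∀ x y → Dec (x ⊏ y)
  x ⊏? y = (x ⊑? y) ×-dec ¬? (x ≟F y)

  IsAtom : Fin n → Set
  IsAtom a = (bot ⊏ a) × (∀ z → bot ⊏ z → z ⊑ a → z ≡ a)

  isAtom? : ∀ a → Dec (IsAtom a)
  isAtom? a = (bot ⊏? a) ×-dec all? (λ z → (bot ⊏? z) →-dec ((z ⊑? a) →-dec (z ≟F a)))

  atomsBelow : Fin n → Subset n
  atomsBelow x = tabulate (λ a → does (isAtom? a ×-dec (a ⊑? x)))

  rank : Fin n → ℕ
  rank x = ∣ atomsBelow x ∣

  -- u ∈ x ∨ y : u is a minimal common upper bound of x and y
  IsMinUB : Fin n → Fin n → Fin n → Set
  IsMinUB x y u = x ⊑ u × y ⊑ u × (∀ w → x ⊑ w → y ⊑ w → w ⊑ u → w ≡ u)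

  -- ℓ ∈ x ∧ y : ℓ is a maximal common lower bound of x and y
  IsMaxLB : Fin n → Fin n → Fin n → Set
  IsMaxLB x y ℓ = ℓ ⊑ x × ℓ ⊑ y × (∀ w → w ⊑ x → w ⊑ y → ℓ ⊑ w → w ≡ ℓ)

record SimplicialPoset : Set₁ where
  field
    n        : ℕ
    _⊑_      : Fin n → Fin n → Set
    _⊑?_     : ∀ x y → Dec (x ⊑ y)
    isPO     : IsPartialOrder _≡_ _⊑_
    bot      : Fin n
    bot-min  : ∀ x → bot ⊑ x
  open PosetNotions _⊑_ _⊑?_ bot public
  field
    -- S_{≤x} ≅ Boolean lattice of subsets of atoms below x, via y ↦ atomsBelow y:
    -- surjective onto subsets of atomsBelow x ...
    bool-surj : ∀ x (A : Subset n) → A ⊆ atomsBelow x →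
                ∃ λ y → y ⊑ x × atomsBelow y ≡ A
    -- ... and order-reflecting (hence injective; monotone by definition)
    bool-refl : ∀ x y z → y ⊑ x → z ⊑ x → atomsBelow y ⊆ atomsBelow z → y ⊑ z

record MatroidScheme : Set₁ where
  field
    S : SimplicialPoset
  open SimplicialPoset S public
  field
    ρ  : Fin n → ℕ
    M1 : ∀ x → ρ x ≤ rank x
    M2 : ∀ x y → x ⊑ y → ρ x ≤ ρ y
    M3 : ∀ x y u ℓ → IsMinUB x y u → IsMaxLB x y ℓ → ρ u + ρ ℓ ≤ ρ x + ρ y
    M4 : ∀ x y ℓ → IsMaxLB x y ℓ → ρ x ≡ ρ ℓ → ∃ λ u → IsMinUB x y u
    M5 : ∀ x y → ρ x < ρ y →
         ∃ λ a → IsAtom a × a ⊑ y × ¬ (a ⊑ x) × ∃ λ u → IsMinUB x a u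

  InFlatOf : Fin n → Fin n → Set
  InFlatOf x y = x ⊑ y × ρ y ≡ ρ x

  MaximalInFlat : Fin n → Fin n → Set
  MaximalInFlat x c = InFlatOf x c × (∀ y → InFlatOf x y → c ⊑ y → y ≡ c)

  IsClosure : Fin n → Fin n → Set
  IsClosure x c = MaximalInFlat x c × (∀ d → MaximalInFlat x d → d ≡ c)

-- Every member y of the flat of x (x ⊑ y, ρ y = ρ x) lies below cl x, because cl y is
-- then a maximal member of that flat and so equals cl x.
-- For CL2 take a maximal common lower bound ℓ of cl x and cl y above x: it has the
-- rank of cl x, so M4 gives a join u of cl x and cl y, and M3 forces ρ u = ρ y, whence
-- cl x ⊑ u ⊑ cl y. For CL4 take v minimal among the upper bounds of x and a below cl u;
-- it is a join of x and a, and a ⋢ cl x gives ρ x < ρ v, while M3 bounds ρ u by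
-- ρ x + 1. So v ⊑ cl u have equal rank and b ⊑ cl u ⊑ cl v.
module Submission where

open import Defs
open import Data.Fin using (Fin) renaming (_≟_ to _≟F_)
open import Data.Fin.Induction using (po-noetherian)
open import Data.Fin.Properties using (any?)
open import Data.Fin.Subset using (_∈_; _⊆_; ⁅_⁆; ∣_∣)
open import Data.Fin.Subset.Properties using (p⊆q⇒∣p∣≤∣q∣; ∣⁅x⁆∣≡1; x∈⁅x⁆)
open import Data.Vec using (tabulate)
open import Data.Vec.Properties using (lookup∘tabulate; []=⇒lookup)
open import Data.Bool using (Bool; true)
open import Data.Nat using (suc; _+_; _≤_; _<_)
open import Data.Nat.Properties
  using (≤-antisym; ≤-trans; ≤∧≢⇒<; +-cancelʳ-≤; +-monoʳ-≤; +-comm; m≤m+n; module ≤-Reasoning)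
open import Data.Product using (_×_; ∃; _,_; proj₁; proj₂)
open import Function using (flip; _∘_)
open import Induction.WellFounded using (Acc; acc)
open import Relation.Binary.Construct.Flip.EqAndOrd using () renaming (isPartialOrder to flip-isPartialOrder)
open import Relation.Binary.Definitions using (Decidable)
open import Relation.Binary.PropositionalEquality using (_≡_; sym; trans; subst; cong)
open import Relation.Binary.Structures using (IsPartialOrder)
open import Relation.Nullary using (¬_; Dec; does; yes; no; _×-dec_; ¬?; contradiction)
open import Relation.Unary using (Pred) renaming (Decidable to Decidable₁)

module FinitePartialOrder {n ℓ} {_≤_ : Fin n → Fin n → Set ℓ}
       (isPO : IsPartialOrder _≡_ _≤_) (_≤?_ : Decidable _≤_) where
  private module ≤ = IsPartialOrder isPO

  maximal-above : ∀ {p} {P : Pred (Fin n) p} → Decidable₁ P → ∀ {m} → P m →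
                  ∃ λ c → m ≤ c × P c × (∀ w → P w → c ≤ w → w ≡ c)
  maximal-above {P = P} P? {m} = go m (po-noetherian isPO m)
    where
    go : ∀ m → Acc _ m → P m → ∃ λ c → m ≤ c × P c × (∀ w → P w → c ≤ w → w ≡ c)
    go m (acc above) Pm with any? (λ w → P? w ×-dec ((m ≤? w) ×-dec ¬? (m ≟F w)))
    ... | yes (w , Pw , m<w) =
      let c , w≤c , Pc , c-max = go w (above m<w) Pw
      in c , ≤.trans (proj₁ m<w) w≤c , Pc , c-max
    ... | no nothing-above = m , ≤.refl , Pm , m-max
      where
      m-max : ∀ w → P w → m ≤ w → w ≡ m
      m-max w Pw m≤w with m ≟F w
      ... | yes m≡w = sym m≡w
      ... | no m≢w = contradiction (w , Pw , m≤w , m≢w) nothing-above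

module FiniteDualPartialOrder {n ℓ} {_≤_ : Fin n → Fin n → Set ℓ}
       (isPO : IsPartialOrder _≡_ _≤_) (_≤?_ : Decidable _≤_) =
  FinitePartialOrder (flip-isPartialOrder isPO) (flip _≤?_)
    renaming (maximal-above to minimal-below)

does-true⁻ : ∀ {a} {A : Set a} (a? : Dec A) → does a? ≡ true → A
does-true⁻ (yes a) _ = a
does-true⁻ (no _) ()

∈-tabulate⁻ : ∀ {n} (f : Fin n → Bool) {z} → z ∈ tabulate f → f z ≡ true
∈-tabulate⁻ f {z} z∈ = trans (sym (lookup∘tabulate f z)) ([]=⇒lookup z∈)

module _ (M : MatroidScheme) where
  open MatroidScheme M
  private module ⊑ = IsPartialOrder isPO
  open FinitePartialOrder isPO _⊑?_
  open FiniteDualPartialOrder isPO _⊑?_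

  atomsBelow⁻ : ∀ {x z} → z ∈ atomsBelow x → IsAtom z × z ⊑ x
  atomsBelow⁻ {x} {z} z∈ =
    does-true⁻ (isAtom? z ×-dec (z ⊑? x)) (∈-tabulate⁻ _ z∈)

  ρ-atom≤1 : ∀ {b} → IsAtom b → ρ b ≤ 1
  ρ-atom≤1 {b} (_ , covers) = begin
    ρ b               ≤⟨ M1 b ⟩
    rank b            ≤⟨ p⊆q⇒∣p∣≤∣q∣ atomsBelow-atom ⟩
    ∣ ⁅ b ⁆ ∣         ≡⟨ ∣⁅x⁆∣≡1 b ⟩
    1                 ∎
    where
    open ≤-Reasoning
    atomsBelow-atom : atomsBelow b ⊆ ⁅ b ⁆
    atomsBelow-atom z∈ with (bot<z , _) , z⊑b ← atomsBelow⁻ z∈ =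
      subst (_∈ ⁅ b ⁆) (sym (covers _ bot<z z⊑b)) (x∈⁅x⁆ b)

  bot-maxLB-atom : ∀ {x b} → IsAtom b → ¬ (b ⊑ x) → IsMaxLB x b bot
  bot-maxLB-atom {x} {b} (_ , covers) b⋢x = bot-min x , bot-min b , below-both
    where
    below-both : ∀ w → w ⊑ x → w ⊑ b → bot ⊑ w → w ≡ bot
    below-both w w⊑x w⊑b _ with w ≟F bot
    ... | yes w≡bot = w≡bot
    ... | no w≢bot = contradiction (subst (_⊑ x) (covers w (bot-min w , w≢bot ∘ sym) w⊑b) w⊑x) b⋢x

  ρ-join≤-of-meet : ∀ {x y u ℓ} → IsMinUB x y u → IsMaxLB x y ℓ → ρ x ≡ ρ ℓ → ρ u ≤ ρ y
  ρ-join≤-of-meet {x} {y} {u} {ℓ} u∈x∨y ℓ∈x∧y ρx≡ρℓ = +-cancelʳ-≤ (ρ ℓ) (ρ u) (ρ y) (begin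
    ρ u + ρ ℓ ≤⟨ M3 x y u ℓ u∈x∨y ℓ∈x∧y ⟩
    ρ x + ρ y ≡⟨ cong (_+ ρ y) ρx≡ρℓ ⟩
    ρ ℓ + ρ y ≡⟨ +-comm (ρ ℓ) (ρ y) ⟩
    ρ y + ρ ℓ ∎)
    where open ≤-Reasoning

  ρ-join-atom≤ : ∀ {x b u} → IsAtom b → ¬ (b ⊑ x) → IsMinUB x b u → ρ u ≤ suc (ρ x)
  ρ-join-atom≤ {x} {b} {u} b-atom b⋢x u∈x∨b = begin
    ρ u           ≤⟨ m≤m+n (ρ u) (ρ bot) ⟩
    ρ u + ρ bot   ≤⟨ M3 x b u bot u∈x∨b (bot-maxLB-atom b-atom b⋢x) ⟩
    ρ x + ρ b     ≤⟨ +-monoʳ-≤ (ρ x) (ρ-atom≤1 b-atom) ⟩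
    ρ x + 1       ≡⟨ +-comm (ρ x) 1 ⟩
    suc (ρ x)     ∎
    where open ≤-Reasoning

  module Closure (cl : Fin n → Fin n) (isClosure : ∀ x → IsClosure x (cl x)) where

    ⊑-cl : ∀ x → x ⊑ cl x
    ⊑-cl x = proj₁ (proj₁ (proj₁ (isClosure x)))

    ρ-cl : ∀ x → ρ (cl x) ≡ ρ x
    ρ-cl x = proj₂ (proj₁ (proj₁ (isClosure x)))

    cl-flat : ∀ {x y} → InFlatOf x y → cl y ≡ cl x
    cl-flat {x} {y} (x⊑y , ρy≡ρx) = proj₂ (isClosure x) (cl y) (cly∈flat-x , cly-maximal)
      where
      cly∈flat-x : InFlatOf x (cl y)
      cly∈flat-x = ⊑.trans x⊑y (⊑-cl y) , trans (ρ-cl y) ρy≡ρx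
      cly-maximal : ∀ w → InFlatOf x w → cl y ⊑ w → w ≡ cl y
      cly-maximal w (_ , ρw≡ρx) cly⊑w =
        proj₂ (proj₁ (isClosure y)) w (⊑.trans (⊑-cl y) cly⊑w , trans ρw≡ρx (sym ρy≡ρx)) cly⊑w

    flat⊑cl : ∀ {x y} → InFlatOf x y → y ⊑ cl x
    flat⊑cl {y = y} y∈flat = subst (y ⊑_) (cl-flat y∈flat) (⊑-cl y)

    cl-idem : ∀ x → cl (cl x) ≡ cl x
    cl-idem x = cl-flat (⊑-cl x , ρ-cl x)

    cl-mono : ∀ x y → x ⊑ y → cl x ⊑ cl y
    cl-mono x y x⊑y
      with maximal-above (λ w → (w ⊑? cl x) ×-dec (w ⊑? cl y)) (⊑-cl x , ⊑.trans x⊑y (⊑-cl y))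
    ... | ℓ , x⊑ℓ , (ℓ⊑clx , ℓ⊑cly) , ℓ-max = join⊑cly (M4 (cl x) (cl y) ℓ ℓ∈clx∧cly ρclx≡ρℓ)
      where
      ℓ∈clx∧cly : IsMaxLB (cl x) (cl y) ℓ
      ℓ∈clx∧cly = ℓ⊑clx , ℓ⊑cly , λ w w⊑clx w⊑cly ℓ⊑w → ℓ-max w (w⊑clx , w⊑cly) ℓ⊑w
      ρclx≡ρℓ : ρ (cl x) ≡ ρ ℓ
      ρclx≡ρℓ = ≤-antisym (subst (_≤ ρ ℓ) (sym (ρ-cl x)) (M2 x ℓ x⊑ℓ)) (M2 ℓ (cl x) ℓ⊑clx)
      join⊑cly : ∃ (IsMinUB (cl x) (cl y)) → cl x ⊑ cl y
      join⊑cly (u , u∈clx∨cly@(clx⊑u , cly⊑u , _)) = ⊑.trans clx⊑u (flat⊑cl (y⊑u , ρu≡ρy))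
        where
        y⊑u : y ⊑ u
        y⊑u = ⊑.trans (⊑-cl y) cly⊑u
        ρu≡ρy : ρ u ≡ ρ y
        ρu≡ρy = ≤-antisym (subst (ρ u ≤_) (ρ-cl y) (ρ-join≤-of-meet u∈clx∨cly ℓ∈clx∧cly ρclx≡ρℓ))
                          (M2 y u y⊑u)

    cl-exchange : ∀ x a b u → IsAtom a → IsAtom b → IsMinUB x b u → a ⊑ cl u → ¬ (a ⊑ cl x) →
                  ∃ λ v → IsMinUB x a v × v ⊑ cl u × b ⊑ cl v
    cl-exchange x a b u _ b-atom u∈x∨b@(x⊑u , b⊑u , u-min) a⊑clu a⋢clx
      with minimal-below (λ w → (x ⊑? w) ×-dec ((a ⊑? w) ×-dec (w ⊑? cl u)))
                         (⊑.trans x⊑u (⊑-cl u) , a⊑clu , ⊑.refl)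
    ... | v , v⊑clu , (x⊑v , a⊑v , _) , v-min =
      v , v∈x∨a , v⊑clu , ⊑.trans b⊑u (⊑.trans (⊑-cl u) (flat⊑cl (v⊑clu , ρclu≡ρv)))
      where
      v∈x∨a : IsMinUB x a v
      v∈x∨a = x⊑v , a⊑v , λ w x⊑w a⊑w w⊑v → v-min w (x⊑w , a⊑w , ⊑.trans w⊑v v⊑clu) w⊑v
      b⋢x : ¬ (b ⊑ x)
      b⋢x b⊑x = a⋢clx (subst (λ t → a ⊑ cl t) (sym (u-min x ⊑.refl b⊑x x⊑u)) a⊑clu)
      ρx<ρv : ρ x < ρ v
      ρx<ρv = ≤∧≢⇒< (M2 x v x⊑v) (λ ρx≡ρv → a⋢clx (⊑.trans a⊑v (flat⊑cl (x⊑v , sym ρx≡ρv))))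
      ρclu≡ρv : ρ (cl u) ≡ ρ v
      ρclu≡ρv = ≤-antisym
        (subst (_≤ ρ v) (sym (ρ-cl u)) (≤-trans (ρ-join-atom≤ b-atom b⋢x u∈x∨b) ρx<ρv))
        (M2 v (cl u) v⊑clu)

proposition5p4 : (M : MatroidScheme) → let open MatroidScheme M in
    (cl : Fin n → Fin n) → (∀ x → IsClosure x (cl x)) →
      (∀ x → x ⊑ cl x)
    × (∀ x y → x ⊑ y → cl x ⊑ cl y)
    × (∀ x → cl (cl x) ≡ cl x)
    × (∀ x a b u → IsAtom a → IsAtom b → IsMinUB x b u → a ⊑ cl u → ¬ (a ⊑ cl x) →
         ∃ λ v → IsMinUB x a v × v ⊑ cl u × b ⊑ cl v)
proposition5p4 M cl isClosure = ⊑-cl , cl-mono , cl-idem , cl-exchange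
  where open Closure M cl isClosure
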